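{- (Terms cannot be typed with themselves.) Let $g:\mathbb N\to\mathbb N$ satisfy $h<g(h)$ for all $h$. For every environment $C$ and terms $T,U$: if $C\vdash_g T:U$, then $C\vdash U\Leftrightarrow T$ does not hold.
   Context: Terms of $\lambda\delta$: $T ::= \ast h \mid x \mid \lambda x{:}W.\,T \mid \delta x{=}V.\,T \mid \mathrm{appl}(V,T) \mid \mathrm{cast}(W,T)$ ($h\in\mathbb N$, $x$ a variable); $\ast h$ is a sort, $\lambda x{:}W.T$ abstraction over type $W$, $\delta x{=}V.T$ the abbreviation "let $x=V$ in $T$", $\mathrm{appl}(V,T)$ application of $T$ to argument $V$, $\mathrm{cast}(W,T)$ $T$ annotated with type $W$. In $\lambda x{:}W.T$, $\delta x{=}V.T$, $x$ is bound in $T$ only; $\mathrm{FV}(T)$ free variables; terms up to renaming of bound variables with bound and free names disjoint. Environments: $E ::= \ast h \mid \lambda x{:}W.E \mid \delta x{=}V.E \mid \mathrm{appl}(V,E)\mid\mathrm{cast}(W,E)$. $E.\lambda x{:}W$ (resp. $E.\delta x{=}V$) is $E$ with its terminal sort $\ast h$ replaced by $\lambda x{:}W.\ast h$ (resp. $\delta x{=}V.\ast h$). $E=C_1\cdot\beta\cdot C_2$, for an item $\beta$ of the form $\lambda x{:}W$ or $\delta x{=}V$, means $E$ is obtained from the environment $C_1$ by replacing its terminal sort with $\beta.C_2$ for some environment $C_2$. Strict substitution: $T[x:=^+W]\,T'$ iff $x\notin\mathrm{FV}(W)$, $x\in\mathrm{FV}(T)$ and $T'$ arises from $T$ by replacing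 a nonempty set of free occurrences of $x$ by $W$. Environment-free parallel reduction $\to_0$: least relation closed under (refl) $T\to_0T$; (compatibility) if $A_1\to_0A_2$, $T_1\to_0T_2$ then $\lambda x{:}A_1.T_1\to_0\lambda x{:}A_2.T_2$, $\delta x{=}A_1.T_1\to_0\delta x{=}A_2.T_2$, $\mathrm{appl}(A_1,T_1)\to_0\mathrm{appl}(A_2,T_2)$, $\mathrm{cast}(A_1,T_1)\to_0\mathrm{cast}(A_2,T_2)$; ($\beta$) if $V_1\to_0V_2$, $T_1\to_0T_2$ then $\mathrm{appl}(V_1,\lambda x{:}W.T_1)\to_0\delta x{=}V_2.T_2$; ($\delta$) if $V_1\to_0V_2$, $T_1\to_0T_2$, $T_2[x:=^+V_2]T$ then $\delta x{=}V_1.T_1\to_0\delta x{=}V_2.T$; ($\zeta$) if $T_1\to_0T_2$, $x\notin\mathrm{FV}(T_1)$ then $\delta x{=}V.T_1\to_0T_2$; ($\tau$) if $T_1\to_0T_2$ then $\mathrm{cast}(W,T_1)\to_0T_2$; ($\upsilon$) if $V_1\to_0V_3$, $V_2\to_0V_4$, $T_1\to_0T_2$ then $\mathrm{appl}(V_1,\delta x{=}V_2.T_1)\to_0\delta x{=}V_4.\mathrm{appl}(V_3,T_2)$. $E\vdash T_1\to T_2$ iff $T_1\to_0T_2$, or $E=C_1\cdot\delta x{=}V\cdot C_2$, $T_1\to_0T'$, $T'[x:=^+V]T_2$. Conversion $E\vdash T_1\Leftrightarrow T_2$ is its symmetric and transitive closure. Native type assignment $E\vdash_g T:U$ is the least relation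 closed under: (sort) $E\vdash_g\ast h:\ast g(h)$; (def) if $E=C_1\cdot\delta x{=}V\cdot C_2$ and $C_1\vdash_g V:W$ then $E\vdash_g x:W$; (decl) if $E=C_1\cdot\lambda x{:}W\cdot C_2$ and $C_1\vdash_g W:V$ then $E\vdash_g x:W$; (abbr) if $E\vdash_g V:W$ and $E.\delta x{=}V\vdash_g T:U$ then $E\vdash_g\delta x{=}V.T:\delta x{=}V.U$; (abst) if $E\vdash_g W:V$ and $E.\lambda x{:}W\vdash_g T:U$ then $E\vdash_g\lambda x{:}W.T:\lambda x{:}W.U$; (appl) if $E\vdash_g V:W$ and $E\vdash_g T:\lambda x{:}W.U$ then $E\vdash_g\mathrm{appl}(V,T):\mathrm{appl}(V,\lambda x{:}W.U)$; (cast) if $E\vdash_g T:W$ and $E\vdash_g W:V$ then $E\vdash_g\mathrm{cast}(W,T):\mathrm{cast}(V,W)$; (conv) if $E\vdash_g U_2:W$, $E\vdash_g T:U_1$ and $E\vdash U_1\Leftrightarrow U_2$ then $E\vdash_g T:U_2$. -}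

module Defs where

-- The λδ calculus of the paper, with variables represented by de Bruijn
-- indices (terms up to renaming of bound variables; the variable convention
-- "bound and free names are disjoint" is what makes the named presentation
-- capture-free, and corresponds here to the explicit lifts below).

open import Data.Nat using (ℕ; zero; suc; _+_; _<ᵇ_; _<_)
open import Data.Bool using (Bool; true; false; _∨_; if_then_else_)
open import Relation.Binary.PropositionalEquality using (_≡_)
open import Relation.Binary.Construct.Closure.Equivalence using (EqClosure)

-- Terms:  T ::= *h | x | λx:W.T | δx=V.T | appl(V,T) | cast(W,T)
-- In  lam W T  and  abbr V T  the body T is under one binder (index 0).

data Term : Set where
  sort : ℕ → Term
  var  : ℕ → Term
  lam  : Term → Term → Term
  abbr : Term → Term → Term
  appl : Term → Term → Term
  cast : Term → Term → Term

lift : ℕ → ℕ → Term → Term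
lift d c (sort h)   = sort h
lift d c (var i)    = if i <ᵇ c then var i else var (i + d)
lift d c (lam W T)  = lam (lift d c W) (lift d (suc c) T)
lift d c (abbr V T) = abbr (lift d c V) (lift d (suc c) T)
lift d c (appl V T) = appl (lift d c V) (lift d c T)
lift d c (cast W T) = cast (lift d c W) (lift d c T)

-- Substitution of a (possibly empty) set of free occurrences of the
-- variable with index i by W.  The Bool records whether at least one
-- occurrence was replaced.

data Sub : ℕ → Term → Term → Term → Bool → Set where
  s-sort : ∀ {i W h} → Sub i W (sort h) (sort h) false
  s-keep : ∀ {i W j} → Sub i W (var j) (var j) false
  s-repl : ∀ {i W}   → Sub i W (var i) W true
  s-lam  : ∀ {i W A A′ T T′ b₁ b₂} →
           Sub i W A A′ b₁ → Sub (suc i) (lift 1 0 W) T T′ b₂ →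
           Sub i W (lam A T) (lam A′ T′) (b₁ ∨ b₂)
  s-abbr : ∀ {i W A A′ T T′ b₁ b₂} →
           Sub i W A A′ b₁ → Sub (suc i) (lift 1 0 W) T T′ b₂ →
           Sub i W (abbr A T) (abbr A′ T′) (b₁ ∨ b₂)
  s-appl : ∀ {i W A A′ T T′ b₁ b₂} →
           Sub i W A A′ b₁ → Sub i W T T′ b₂ →
           Sub i W (appl A T) (appl A′ T′) (b₁ ∨ b₂)
  s-cast : ∀ {i W A A′ T T′ b₁ b₂} →
           Sub i W A A′ b₁ → Sub i W T T′ b₂ →
           Sub i W (cast A T) (cast A′ T′) (b₁ ∨ b₂)

-- strict substitution  T[x:=⁺W]T′  (nonempty set of occurrences);
-- the side condition x ∉ FV(W) holds automatically at every use below,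
-- since W is always a lifted term there.
StrictSub : ℕ → Term → Term → Term → Set
StrictSub i W T T′ = Sub i W T T′ true

infix 4 _⇒₀_
data _⇒₀_ : Term → Term → Set where
  r-refl : ∀ {T} → T ⇒₀ T
  r-lam  : ∀ {A₁ A₂ T₁ T₂} → A₁ ⇒₀ A₂ → T₁ ⇒₀ T₂ → lam A₁ T₁ ⇒₀ lam A₂ T₂
  r-abbr : ∀ {A₁ A₂ T₁ T₂} → A₁ ⇒₀ A₂ → T₁ ⇒₀ T₂ → abbr A₁ T₁ ⇒₀ abbr A₂ T₂
  r-appl : ∀ {A₁ A₂ T₁ T₂} → A₁ ⇒₀ A₂ → T₁ ⇒₀ T₂ → appl A₁ T₁ ⇒₀ appl A₂ T₂
  r-cast : ∀ {A₁ A₂ T₁ T₂} → A₁ ⇒₀ A₂ → T₁ ⇒₀ T₂ → cast A₁ T₁ ⇒₀ cast A₂ T₂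
  r-β    : ∀ {V₁ V₂ W T₁ T₂} → V₁ ⇒₀ V₂ → T₁ ⇒₀ T₂ →
           appl V₁ (lam W T₁) ⇒₀ abbr V₂ T₂
  r-δ    : ∀ {V₁ V₂ T₁ T₂ T} → V₁ ⇒₀ V₂ → T₁ ⇒₀ T₂ →
           StrictSub 0 (lift 1 0 V₂) T₂ T →
           abbr V₁ T₁ ⇒₀ abbr V₂ T
  -- (ζ) δx=V.T₁ →₀ T₂  if x ∉ FV(T₁)   (T₁ is the lift of a term T₁′)
  r-ζ    : ∀ {V T₁ T₂} → T₁ ⇒₀ T₂ → abbr V (lift 1 0 T₁) ⇒₀ T₂
  r-τ    : ∀ {W T₁ T₂} → T₁ ⇒₀ T₂ → cast W T₁ ⇒₀ T₂
  r-υ    : ∀ {V₁ V₂ V₃ V₄ T₁ T₂} → V₁ ⇒₀ V₃ → V₂ ⇒₀ V₄ → T₁ ⇒₀ T₂ →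
           appl V₁ (abbr V₂ T₁) ⇒₀ abbr V₄ (appl (lift 1 0 V₃) T₂)

data Env : Set where
  ⋆     : ℕ → Env
  lamE  : Term → Env → Env
  abbrE : Term → Env → Env
  applE : Term → Env → Env
  castE : Term → Env → Env

graft : Env → Env → Env
graft (⋆ h)       D = D
graft (lamE W C)  D = lamE W (graft C D)
graft (abbrE V C) D = abbrE V (graft C D)
graft (applE V C) D = applE V (graft C D)
graft (castE W C) D = castE W (graft C D)

tsort : Env → ℕ
tsort (⋆ h)       = h
tsort (lamE _ C)  = tsort C
tsort (abbrE _ C) = tsort C
tsort (applE _ C) = tsort C
tsort (castE _ C) = tsort C

_∙λ_ : Env → Term → Env
E ∙λ W = graft E (lamE W (⋆ (tsort E)))

_∙δ_ : Env → Term → Env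
E ∙δ V = graft E (abbrE V (⋆ (tsort E)))

binders : Env → ℕ
binders (⋆ _)       = 0
binders (lamE _ C)  = suc (binders C)
binders (abbrE _ C) = suc (binders C)
binders (applE _ C) = binders C
binders (castE _ C) = binders C

-- In E = C₁·β·C₂ the variable bound by β has index  binders C₂  in E, and
-- a term living in C₁ is seen in E lifted by  suc (binders C₂).

data _⊢_⇒_ (E : Env) : Term → Term → Set where
  e-free : ∀ {T₁ T₂} → T₁ ⇒₀ T₂ → E ⊢ T₁ ⇒ T₂
  e-δ    : ∀ {C₁ C₂ V T₁ T′ T₂} → E ≡ graft C₁ (abbrE V C₂) →
           T₁ ⇒₀ T′ →
           StrictSub (binders C₂) (lift (suc (binders C₂)) 0 V) T′ T₂ →
           E ⊢ T₁ ⇒ T₂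

-- E ⊢ T₁ ⇔ T₂ : symmetric and transitive closure (reflexivity is already
-- contained in E ⊢ _ ⇒ _)
_⊢_⇔_ : Env → Term → Term → Set
E ⊢ T₁ ⇔ T₂ = EqClosure (E ⊢_⇒_) T₁ T₂

data _⊢[_]_∶_ : Env → (ℕ → ℕ) → Term → Term → Set where
  t-sort : ∀ {E g h} → E ⊢[ g ] sort h ∶ sort (g h)
  t-def  : ∀ {E g C₁ C₂ V W} → E ≡ graft C₁ (abbrE V C₂) →
           C₁ ⊢[ g ] V ∶ W →
           E ⊢[ g ] var (binders C₂) ∶ lift (suc (binders C₂)) 0 W
  t-decl : ∀ {E g C₁ C₂ V W} → E ≡ graft C₁ (lamE W C₂) →
           C₁ ⊢[ g ] W ∶ V →
           E ⊢[ g ] var (binders C₂) ∶ lift (suc (binders C₂)) 0 W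
  t-abbr : ∀ {E g V W T U} → E ⊢[ g ] V ∶ W → (E ∙δ V) ⊢[ g ] T ∶ U →
           E ⊢[ g ] abbr V T ∶ abbr V U
  t-abst : ∀ {E g V W T U} → E ⊢[ g ] W ∶ V → (E ∙λ W) ⊢[ g ] T ∶ U →
           E ⊢[ g ] lam W T ∶ lam W U
  t-appl : ∀ {E g V W T U} → E ⊢[ g ] V ∶ W → E ⊢[ g ] T ∶ lam W U →
           E ⊢[ g ] appl V T ∶ appl V (lam W U)
  t-cast : ∀ {E g T W V} → E ⊢[ g ] T ∶ W → E ⊢[ g ] W ∶ V →
           E ⊢[ g ] cast W T ∶ cast V W
  t-conv : ∀ {E g T U₁ U₂ W} → E ⊢[ g ] U₂ ∶ W → E ⊢[ g ] T ∶ U₁ →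
           E ⊢ U₁ ⇔ U₂ → E ⊢[ g ] T ∶ U₂

{-# OPTIONS --safe #-}
module Submission where

-- Erasing casts and expanding abbreviations maps λδ into a pure λ-calculus with sorts, whose
-- parallel reduction has the diamond property, so convertible terms have a common reduct.
-- There terms get skeletons: simple types over degrees, where the sort h has degree (h , 0).
-- For a skeleton s, s ⁻ is the skeleton of the types of the terms of skeleton s and s ⁺ that of
-- their inhabitants.  If C ⊢_g T : U then, in any context fitting C, T has some skeleton s and
-- U has s ⁻.  Skeletons are unique up to ≈ and stable under reduction, so U ⇔ T would give
-- s ⁻ ≈ s, which h < g h rules out.  A context fits C if it gives each declared variable the
-- skeleton a ⁺ whenever its type has skeleton a.

open import Defs
open import Data.Bool using (true; false; if_then_else_)
open import Data.Empty using (⊥-elim)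
open import Data.List using (List; []; _∷_; _++_; length)
open import Data.List.Properties using (++-assoc; ++-identityʳ; length-++)
open import Data.Nat using (ℕ; zero; suc; _+_; _<_; _<ᵇ_)
open import Data.Nat.Properties
  using (+-assoc; +-comm; +-suc; +-identityʳ; +-cancelʳ-≡; <-irrefl; +-commutativeSemigroup)
open import Algebra.Properties.CommutativeSemigroup +-commutativeSemigroup using (x∙yz≈y∙xz)
open import Data.Product using (∃; ∃₂; ∃-syntax; _×_; _,_; proj₁; proj₂)
open import Data.Unit using (⊤; tt)
open import Effect.Monad using (RawMonad)
open import Function using (_∘_; id)
open import Function.Endo.Propositional ℕ using (_^_; ^-homo)
open import Level using (0ℓ)
open import Relation.Binary.Core using (Rel)
open import Relation.Binary.PropositionalEquality as ≡
  using (_≡_; _≗_; refl; sym; trans; cong; cong₂; module ≡-Reasoning)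
open import Relation.Binary.Construct.Closure.Equivalence as EqClosure using (EqClosure)
open import Relation.Binary.Construct.Closure.ReflexiveTransitive using (Star; ε; _◅_; _◅◅_)
open import Relation.Binary.Construct.Closure.Symmetric using (fwd; bwd)
open import Relation.Nullary using (¬_; Dec; yes; no)
open import Relation.Nullary.Decidable using (¬¬-excluded-middle)
open import Relation.Nullary.Negation using (¬¬-Monad)

module ChurchRosser {A : Set} {_⟶_ : Rel A 0ℓ}
  (diamond : ∀ {a b c} → a ⟶ b → a ⟶ c → ∃[ d ] b ⟶ d × c ⟶ d) where

  strip : ∀ {a b c} → a ⟶ b → Star _⟶_ a c → ∃[ d ] Star _⟶_ b d × c ⟶ d
  strip a⟶b ε = _ , ε , a⟶b
  strip a⟶b (a⟶a′ ◅ a′⟶*c) with diamond a⟶b a⟶a′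
  ... | e , b⟶e , a′⟶e with strip a′⟶e a′⟶*c
  ...   | d , e⟶*d , c⟶d = d , b⟶e ◅ e⟶*d , c⟶d

  church-rosser : ∀ {a b} → EqClosure _⟶_ a b → ∃[ c ] Star _⟶_ a c × Star _⟶_ b c
  church-rosser ε = _ , ε , ε
  church-rosser (fwd a⟶a′ ◅ a′≡b) with church-rosser a′≡b
  ... | c , a′⟶*c , b⟶*c = c , a⟶a′ ◅ a′⟶*c , b⟶*c
  church-rosser (bwd a′⟶a ◅ a′≡b) with church-rosser a′≡b
  ... | c , a′⟶*c , b⟶*c with strip a′⟶a a′⟶*c
  ...   | d , a⟶*d , c⟶d = d , a⟶*d , b⟶*c ◅◅ (c⟶d ◅ ε)

-- Pure λ-terms with sorts

infixl 7 _·_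
infix  9 `_

data Tm : Set where
  ✶   : ℕ → Tm
  `_  : ℕ → Tm
  ƛ   : Tm → Tm → Tm
  _·_ : Tm → Tm → Tm

Rename : Set
Rename = ℕ → ℕ

Subst : Set
Subst = ℕ → Tm

ext : Rename → Rename
ext ρ zero    = zero
ext ρ (suc i) = suc (ρ i)

rename : Rename → Tm → Tm
rename ρ (✶ h)   = ✶ h
rename ρ (` i)   = ` ρ i
rename ρ (ƛ W T) = ƛ (rename ρ W) (rename (ext ρ) T)
rename ρ (T · V) = rename ρ T · rename ρ V

exts : Subst → Subst
exts σ zero    = ` zero
exts σ (suc i) = rename suc (σ i)

subst : Subst → Tm → Tm
subst σ (✶ h)   = ✶ h
subst σ (` i)   = σ i
subst σ (ƛ W T) = ƛ (subst σ W) (subst (exts σ) T)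
subst σ (T · V) = subst σ T · subst σ V

infixr 5 _•_

_•_ : {A : Set} → A → (ℕ → A) → ℕ → A
(u • σ) zero    = u
(u • σ) (suc i) = σ i

infix 8 _[_]

_[_] : Tm → Tm → Tm
T [ V ] = subst (V • `_) T

ext-cong : ∀ {ρ ρ′} → ρ ≗ ρ′ → ext ρ ≗ ext ρ′
ext-cong eq zero    = refl
ext-cong eq (suc i) = cong suc (eq i)

rename-cong : ∀ {ρ ρ′} → ρ ≗ ρ′ → ∀ t → rename ρ t ≡ rename ρ′ t
rename-cong eq (✶ h)   = refl
rename-cong eq (` i)   = cong `_ (eq i)
rename-cong eq (ƛ W T) = cong₂ ƛ (rename-cong eq W) (rename-cong (ext-cong eq) T)
rename-cong eq (T · V) = cong₂ _·_ (rename-cong eq T) (rename-cong eq V)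

exts-cong : ∀ {σ σ′} → σ ≗ σ′ → exts σ ≗ exts σ′
exts-cong eq zero    = refl
exts-cong eq (suc i) = cong (rename suc) (eq i)

subst-cong : ∀ {σ σ′} → σ ≗ σ′ → ∀ t → subst σ t ≡ subst σ′ t
subst-cong eq (✶ h)   = refl
subst-cong eq (` i)   = eq i
subst-cong eq (ƛ W T) = cong₂ ƛ (subst-cong eq W) (subst-cong (exts-cong eq) T)
subst-cong eq (T · V) = cong₂ _·_ (subst-cong eq T) (subst-cong eq V)

ext-id : ext id ≗ id
ext-id zero    = refl
ext-id (suc i) = refl

rename-id : ∀ t → rename id t ≡ t
rename-id (✶ h)   = refl
rename-id (` i)   = refl
rename-id (ƛ W T) = cong₂ ƛ (rename-id W) (trans (rename-cong ext-id T) (rename-id T))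
rename-id (T · V) = cong₂ _·_ (rename-id T) (rename-id V)

ext-∘ : ∀ ρ ρ′ → ext ρ ∘ ext ρ′ ≗ ext (ρ ∘ ρ′)
ext-∘ ρ ρ′ zero    = refl
ext-∘ ρ ρ′ (suc i) = refl

rename-rename : ∀ ρ ρ′ t → rename ρ (rename ρ′ t) ≡ rename (ρ ∘ ρ′) t
rename-rename ρ ρ′ (✶ h)   = refl
rename-rename ρ ρ′ (` i)   = refl
rename-rename ρ ρ′ (ƛ W T) = cong₂ ƛ (rename-rename ρ ρ′ W)
  (trans (rename-rename (ext ρ) (ext ρ′) T) (rename-cong (ext-∘ ρ ρ′) T))
rename-rename ρ ρ′ (T · V) = cong₂ _·_ (rename-rename ρ ρ′ T) (rename-rename ρ ρ′ V)

exts-ext : ∀ σ ρ → exts σ ∘ ext ρ ≗ exts (σ ∘ ρ)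
exts-ext σ ρ zero    = refl
exts-ext σ ρ (suc i) = refl

subst-rename : ∀ σ ρ t → subst σ (rename ρ t) ≡ subst (σ ∘ ρ) t
subst-rename σ ρ (✶ h)   = refl
subst-rename σ ρ (` i)   = refl
subst-rename σ ρ (ƛ W T) = cong₂ ƛ (subst-rename σ ρ W)
  (trans (subst-rename (exts σ) (ext ρ) T) (subst-cong (exts-ext σ ρ) T))
subst-rename σ ρ (T · V) = cong₂ _·_ (subst-rename σ ρ T) (subst-rename σ ρ V)

rename-exts : ∀ ρ σ → rename (ext ρ) ∘ exts σ ≗ exts (rename ρ ∘ σ)
rename-exts ρ σ zero    = refl
rename-exts ρ σ (suc i) =
  trans (rename-rename (ext ρ) suc (σ i)) (sym (rename-rename suc ρ (σ i)))

rename-subst : ∀ ρ σ t → rename ρ (subst σ t) ≡ subst (rename ρ ∘ σ) t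
rename-subst ρ σ (✶ h)   = refl
rename-subst ρ σ (` i)   = refl
rename-subst ρ σ (ƛ W T) = cong₂ ƛ (rename-subst ρ σ W)
  (trans (rename-subst (ext ρ) (exts σ) T) (subst-cong (rename-exts ρ σ) T))
rename-subst ρ σ (T · V) = cong₂ _·_ (rename-subst ρ σ T) (rename-subst ρ σ V)

subst-exts : ∀ τ σ → subst (exts τ) ∘ exts σ ≗ exts (subst τ ∘ σ)
subst-exts τ σ zero    = refl
subst-exts τ σ (suc i) =
  trans (subst-rename (exts τ) suc (σ i)) (sym (rename-subst suc τ (σ i)))

subst-subst : ∀ τ σ t → subst τ (subst σ t) ≡ subst (subst τ ∘ σ) t
subst-subst τ σ (✶ h)   = refl
subst-subst τ σ (` i)   = refl
subst-subst τ σ (ƛ W T) = cong₂ ƛ (subst-subst τ σ W)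
  (trans (subst-subst (exts τ) (exts σ) T) (subst-cong (subst-exts τ σ) T))
subst-subst τ σ (T · V) = cong₂ _·_ (subst-subst τ σ T) (subst-subst τ σ V)

exts-var : exts `_ ≗ `_
exts-var zero    = refl
exts-var (suc i) = refl

subst-var : ∀ t → subst `_ t ≡ t
subst-var (✶ h)   = refl
subst-var (` i)   = refl
subst-var (ƛ W T) = cong₂ ƛ (subst-var W) (trans (subst-cong exts-var T) (subst-var T))
subst-var (T · V) = cong₂ _·_ (subst-var T) (subst-var V)

subst-[] : ∀ σ T V → subst σ (T [ V ]) ≡ subst (subst σ V • σ) T
subst-[] σ T V = trans (subst-subst σ (V • `_) T) (subst-cong pointwise T)
  where
  pointwise : subst σ ∘ (V • `_) ≗ subst σ V • σ
  pointwise zero    = refl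
  pointwise (suc i) = refl

subst-exts-[] : ∀ σ T V → (subst (exts σ) T) [ V ] ≡ subst (V • σ) T
subst-exts-[] σ T V = trans (subst-subst (V • `_) (exts σ) T) (subst-cong pointwise T)
  where
  pointwise : subst (V • `_) ∘ exts σ ≗ V • σ
  pointwise zero    = refl
  pointwise (suc i) = trans (subst-rename (V • `_) suc (σ i)) (subst-var (σ i))

subst-β : ∀ σ T V → subst σ (T [ V ]) ≡ (subst (exts σ) T) [ subst σ V ]
subst-β σ T V = trans (subst-[] σ T V) (sym (subst-exts-[] σ T (subst σ V)))

rename-β : ∀ ρ T V → rename ρ (T [ V ]) ≡ (rename (ext ρ) T) [ rename ρ V ]
rename-β ρ T V = begin
  rename ρ (T [ V ])                       ≡⟨ rename-subst ρ (V • `_) T ⟩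
  subst (rename ρ ∘ (V • `_)) T            ≡⟨ subst-cong pointwise T ⟩
  subst ((rename ρ V • `_) ∘ ext ρ) T      ≡⟨ sym (subst-rename (rename ρ V • `_) (ext ρ) T) ⟩
  (rename (ext ρ) T) [ rename ρ V ]        ∎
  where
  open ≡-Reasoning
  pointwise : rename ρ ∘ (V • `_) ≗ (rename ρ V • `_) ∘ ext ρ
  pointwise zero    = refl
  pointwise (suc i) = refl

-- Parallel reduction

infix 4 _⇛_

data _⇛_ : Tm → Tm → Set where
  ⇛-✶ : ∀ {h} → ✶ h ⇛ ✶ h
  ⇛-` : ∀ {i} → ` i ⇛ ` i
  ⇛-ƛ : ∀ {W W′ T T′} → W ⇛ W′ → T ⇛ T′ → ƛ W T ⇛ ƛ W′ T′
  ⇛-· : ∀ {T T′ V V′} → T ⇛ T′ → V ⇛ V′ → T · V ⇛ T′ · V′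
  ⇛-β : ∀ {W T T′ V V′} → T ⇛ T′ → V ⇛ V′ → ƛ W T · V ⇛ T′ [ V′ ]

⇛-refl : ∀ {t} → t ⇛ t
⇛-refl {✶ h}   = ⇛-✶
⇛-refl {` i}   = ⇛-`
⇛-refl {ƛ W T} = ⇛-ƛ ⇛-refl ⇛-refl
⇛-refl {T · V} = ⇛-· ⇛-refl ⇛-refl

⇛-rename : ∀ ρ {t t′} → t ⇛ t′ → rename ρ t ⇛ rename ρ t′
⇛-rename ρ ⇛-✶       = ⇛-✶
⇛-rename ρ ⇛-`       = ⇛-`
⇛-rename ρ (⇛-ƛ p q) = ⇛-ƛ (⇛-rename ρ p) (⇛-rename (ext ρ) q)
⇛-rename ρ (⇛-· p q) = ⇛-· (⇛-rename ρ p) (⇛-rename ρ q)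
⇛-rename ρ (⇛-β {T′ = T′} {V′ = V′} p q) rewrite rename-β ρ T′ V′ =
  ⇛-β (⇛-rename (ext ρ) p) (⇛-rename ρ q)

_⇛ˢ_ : Subst → Subst → Set
σ ⇛ˢ τ = ∀ i → σ i ⇛ τ i

⇛ˢ-exts : ∀ {σ τ} → σ ⇛ˢ τ → exts σ ⇛ˢ exts τ
⇛ˢ-exts σ⇛τ zero    = ⇛-`
⇛ˢ-exts σ⇛τ (suc i) = ⇛-rename suc (σ⇛τ i)

⇛ˢ-• : ∀ {V V′ σ τ} → V ⇛ V′ → σ ⇛ˢ τ → (V • σ) ⇛ˢ (V′ • τ)
⇛ˢ-• V⇛V′ σ⇛τ zero    = V⇛V′
⇛ˢ-• V⇛V′ σ⇛τ (suc i) = σ⇛τ i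

⇛-subst : ∀ {σ τ} → σ ⇛ˢ τ → ∀ {t t′} → t ⇛ t′ → subst σ t ⇛ subst τ t′
⇛-subst σ⇛τ ⇛-✶       = ⇛-✶
⇛-subst σ⇛τ (⇛-` {i}) = σ⇛τ i
⇛-subst σ⇛τ (⇛-ƛ p q) = ⇛-ƛ (⇛-subst σ⇛τ p) (⇛-subst (⇛ˢ-exts σ⇛τ) q)
⇛-subst σ⇛τ (⇛-· p q) = ⇛-· (⇛-subst σ⇛τ p) (⇛-subst σ⇛τ q)
⇛-subst {τ = τ} σ⇛τ (⇛-β {T′ = T′} {V′ = V′} p q) rewrite subst-β τ T′ V′ =
  ⇛-β (⇛-subst (⇛ˢ-exts σ⇛τ) p) (⇛-subst σ⇛τ q)

⇛-[] : ∀ {T T′ V V′} → T ⇛ T′ → V ⇛ V′ → T [ V ] ⇛ T′ [ V′ ]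
⇛-[] T⇛T′ V⇛V′ = ⇛-subst (⇛ˢ-• V⇛V′ (λ _ → ⇛-`)) T⇛T′

develop : Tm → Tm
develop (✶ h)         = ✶ h
develop (` i)         = ` i
develop (ƛ W T)       = ƛ (develop W) (develop T)
develop (ƛ W T · V)   = develop T [ develop V ]
develop (T · V)       = develop T · develop V

⇛-develop : ∀ {t u} → t ⇛ u → u ⇛ develop t
⇛-develop ⇛-✶                  = ⇛-✶
⇛-develop ⇛-`                  = ⇛-`
⇛-develop (⇛-ƛ p q)            = ⇛-ƛ (⇛-develop p) (⇛-develop q)
⇛-develop (⇛-· (⇛-ƛ p q) r)    = ⇛-β (⇛-develop q) (⇛-develop r)
⇛-develop (⇛-· p@⇛-✶ r)        = ⇛-· (⇛-develop p) (⇛-develop r)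
⇛-develop (⇛-· p@⇛-` r)        = ⇛-· (⇛-develop p) (⇛-develop r)
⇛-develop (⇛-· p@(⇛-· _ _) r)  = ⇛-· (⇛-develop p) (⇛-develop r)
⇛-develop (⇛-· p@(⇛-β _ _) r)  = ⇛-· (⇛-develop p) (⇛-develop r)
⇛-develop (⇛-β p q)            = ⇛-[] (⇛-develop p) (⇛-develop q)

⇛-diamond : ∀ {a b c} → a ⇛ b → a ⇛ c → ∃[ d ] b ⇛ d × c ⇛ d
⇛-diamond {a} a⇛b a⇛c = develop a , ⇛-develop a⇛b , ⇛-develop a⇛c

open ChurchRosser ⇛-diamond using (church-rosser)

-- Expansion of λδ-terms

⟦_⟧ : Term → Tm
⟦ sort h ⟧     = ✶ h
⟦ var i ⟧      = ` i
⟦ lam W T ⟧    = ƛ ⟦ W ⟧ ⟦ T ⟧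
⟦ abbr V T ⟧   = ⟦ T ⟧ [ ⟦ V ⟧ ]
⟦ appl V T ⟧   = ⟦ T ⟧ · ⟦ V ⟧
⟦ cast W T ⟧   = ⟦ T ⟧

liftVar : ℕ → ℕ → Rename
liftVar d c i = if i <ᵇ c then i else i + d

⟦lift⟧-var : ∀ d c i → ⟦ lift d c (var i) ⟧ ≡ ` liftVar d c i
⟦lift⟧-var d c i with i <ᵇ c
... | true  = refl
... | false = refl

ext-liftVar : ∀ d c → ext (liftVar d c) ≗ liftVar d (suc c)
ext-liftVar d c zero    = refl
ext-liftVar d c (suc i) with i <ᵇ c
... | true  = refl
... | false = refl

⟦lift⟧ : ∀ d c T → ⟦ lift d c T ⟧ ≡ rename (liftVar d c) ⟦ T ⟧
⟦lift⟧ d c (sort h)   = refl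
⟦lift⟧ d c (var i)    = ⟦lift⟧-var d c i
⟦lift⟧ d c (lam W T)  = cong₂ ƛ (⟦lift⟧ d c W) body
  where
  body : ⟦ lift d (suc c) T ⟧ ≡ rename (ext (liftVar d c)) ⟦ T ⟧
  body = trans (⟦lift⟧ d (suc c) T) (sym (rename-cong (ext-liftVar d c) ⟦ T ⟧))
⟦lift⟧ d c (abbr V T) =
  trans (cong₂ _[_] body (⟦lift⟧ d c V)) (sym (rename-β (liftVar d c) ⟦ T ⟧ ⟦ V ⟧))
  where
  body : ⟦ lift d (suc c) T ⟧ ≡ rename (ext (liftVar d c)) ⟦ T ⟧
  body = trans (⟦lift⟧ d (suc c) T) (sym (rename-cong (ext-liftVar d c) ⟦ T ⟧))
⟦lift⟧ d c (appl V T) = cong₂ _·_ (⟦lift⟧ d c T) (⟦lift⟧ d c V)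
⟦lift⟧ d c (cast W T) = ⟦lift⟧ d c T

subst-⟦lift⟧ : ∀ σ n T → subst σ ⟦ lift n 0 T ⟧ ≡ subst (σ ∘ (n +_)) ⟦ T ⟧
subst-⟦lift⟧ σ n T = begin
  subst σ ⟦ lift n 0 T ⟧                ≡⟨ cong (subst σ) (⟦lift⟧ n 0 T) ⟩
  subst σ (rename (liftVar n 0) ⟦ T ⟧)  ≡⟨ subst-rename σ (liftVar n 0) ⟦ T ⟧ ⟩
  subst (σ ∘ liftVar n 0) ⟦ T ⟧         ≡⟨ subst-cong (λ i → cong σ (+-comm i n)) ⟦ T ⟧ ⟩
  subst (σ ∘ (n +_)) ⟦ T ⟧              ∎
  where open ≡-Reasoning

⟦lift₁⟧-[] : ∀ T V → ⟦ lift 1 0 T ⟧ [ V ] ≡ ⟦ T ⟧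
⟦lift₁⟧-[] T V = trans (subst-⟦lift⟧ (V • `_) 1 T) (subst-var ⟦ T ⟧)

subst-⟦Sub⟧ : ∀ {i W T T′ b} → Sub i W T T′ b →
              ∀ σ → σ i ≡ subst σ ⟦ W ⟧ → subst σ ⟦ T′ ⟧ ≡ subst σ ⟦ T ⟧
subst-⟦Sub⟧ s-sort σ σi≡W = refl
subst-⟦Sub⟧ s-keep σ σi≡W = refl
subst-⟦Sub⟧ s-repl σ σi≡W = sym σi≡W
subst-⟦Sub⟧ {i} {W} (s-lam A↦A′ T↦T′) σ σi≡W =
  cong₂ ƛ (subst-⟦Sub⟧ A↦A′ σ σi≡W) (subst-⟦Sub⟧ T↦T′ (exts σ) exts-σ-suc-i≡W)
  where
  exts-σ-suc-i≡W : exts σ (suc i) ≡ subst (exts σ) ⟦ lift 1 0 W ⟧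
  exts-σ-suc-i≡W = begin
    rename suc (σ i)               ≡⟨ cong (rename suc) σi≡W ⟩
    rename suc (subst σ ⟦ W ⟧)     ≡⟨ rename-subst suc σ ⟦ W ⟧ ⟩
    subst (exts σ ∘ suc) ⟦ W ⟧     ≡⟨ sym (subst-⟦lift⟧ (exts σ) 1 W) ⟩
    subst (exts σ) ⟦ lift 1 0 W ⟧  ∎
    where open ≡-Reasoning
subst-⟦Sub⟧ {i} {W} (s-abbr {A = A} {A′} {T} {T′} A↦A′ T↦T′) σ σi≡W = begin
  subst σ (⟦ T′ ⟧ [ ⟦ A′ ⟧ ])        ≡⟨ subst-[] σ ⟦ T′ ⟧ ⟦ A′ ⟧ ⟩
  subst (subst σ ⟦ A′ ⟧ • σ) ⟦ T′ ⟧  ≡⟨ cong (λ a → subst (a • σ) ⟦ T′ ⟧) (subst-⟦Sub⟧ A↦A′ σ σi≡W) ⟩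
  subst (subst σ ⟦ A ⟧ • σ) ⟦ T′ ⟧   ≡⟨ subst-⟦Sub⟧ T↦T′ (subst σ ⟦ A ⟧ • σ) σ-suc-i≡W ⟩
  subst (subst σ ⟦ A ⟧ • σ) ⟦ T ⟧    ≡⟨ sym (subst-[] σ ⟦ T ⟧ ⟦ A ⟧) ⟩
  subst σ (⟦ T ⟧ [ ⟦ A ⟧ ])          ∎
  where
  open ≡-Reasoning
  σ-suc-i≡W : σ i ≡ subst (subst σ ⟦ A ⟧ • σ) ⟦ lift 1 0 W ⟧
  σ-suc-i≡W = trans σi≡W (sym (subst-⟦lift⟧ (subst σ ⟦ A ⟧ • σ) 1 W))
subst-⟦Sub⟧ (s-appl V↦V′ T↦T′) σ σi≡W =
  cong₂ _·_ (subst-⟦Sub⟧ T↦T′ σ σi≡W) (subst-⟦Sub⟧ V↦V′ σ σi≡W)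
subst-⟦Sub⟧ (s-cast _ T↦T′) σ σi≡W = subst-⟦Sub⟧ T↦T′ σ σi≡W

⟦⟧-⇛ : ∀ {T₁ T₂} → T₁ ⇒₀ T₂ → ⟦ T₁ ⟧ ⇛ ⟦ T₂ ⟧
⟦⟧-⇛ r-refl       = ⇛-refl
⟦⟧-⇛ (r-lam p q)  = ⇛-ƛ (⟦⟧-⇛ p) (⟦⟧-⇛ q)
⟦⟧-⇛ (r-abbr p q) = ⇛-[] (⟦⟧-⇛ q) (⟦⟧-⇛ p)
⟦⟧-⇛ (r-appl p q) = ⇛-· (⟦⟧-⇛ q) (⟦⟧-⇛ p)
⟦⟧-⇛ (r-cast _ q) = ⟦⟧-⇛ q
⟦⟧-⇛ (r-β p q)    = ⇛-β (⟦⟧-⇛ q) (⟦⟧-⇛ p)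
⟦⟧-⇛ (r-δ {V₂ = V₂} p q s)
  rewrite subst-⟦Sub⟧ s (⟦ V₂ ⟧ • `_) (sym (⟦lift₁⟧-[] V₂ ⟦ V₂ ⟧)) = ⇛-[] (⟦⟧-⇛ q) (⟦⟧-⇛ p)
⟦⟧-⇛ (r-ζ {V = V} {T₁ = T} p)
  rewrite ⟦lift₁⟧-[] T ⟦ V ⟧ = ⟦⟧-⇛ p
⟦⟧-⇛ (r-τ p)      = ⟦⟧-⇛ p
⟦⟧-⇛ (r-υ {V₃ = V₃} {V₄ = V₄} p q r)
  rewrite ⟦lift₁⟧-[] V₃ ⟦ V₄ ⟧ = ⇛-· (⇛-[] (⟦⟧-⇛ r) (⟦⟧-⇛ q)) (⟦⟧-⇛ p)

module Skeletons (g : ℕ → ℕ) where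

  ^-+ : ∀ m n h → (g ^ (m + n)) h ≡ (g ^ m) ((g ^ n) h)
  ^-+ m n h = cong (λ f → f h) (^-homo g m n)

  ^-comm : ∀ m h → (g ^ m) (g h) ≡ g ((g ^ m) h)
  ^-comm zero    h = refl
  ^-comm (suc m) h = cong g (^-comm m h)

  Degree : Set
  Degree = ℕ × ℕ

  infix 4 _≈ᵈ_

  -- (h , k) is the degree of the terms k levels below the sort h.  The sort h lies one level
  -- below the sort g h, so (h , k) ≈ᵈ (g h , suc k).

  _≈ᵈ_ : Degree → Degree → Set
  (h , k) ≈ᵈ (h′ , k′) = ∃₂ λ m n → (g ^ m) h ≡ (g ^ n) h′ × m + k ≡ n + k′

  ≈ᵈ-refl : ∀ {d} → d ≈ᵈ d
  ≈ᵈ-refl = 0 , 0 , refl , refl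

  ≈ᵈ-sym : ∀ {d e} → d ≈ᵈ e → e ≈ᵈ d
  ≈ᵈ-sym (m , n , hs , ks) = n , m , sym hs , sym ks

  ≈ᵈ-trans : ∀ {d e f} → d ≈ᵈ e → e ≈ᵈ f → d ≈ᵈ f
  ≈ᵈ-trans {h , k} {h′ , k′} {h″ , k″} (m , n , hs , ks) (p , q , hs′ , ks′) =
    p + m , n + q , sorts , levels
    where
    open ≡-Reasoning
    sorts : (g ^ (p + m)) h ≡ (g ^ (n + q)) h″
    sorts = begin
      (g ^ (p + m)) h          ≡⟨ ^-+ p m h ⟩
      (g ^ p) ((g ^ m) h)      ≡⟨ cong (g ^ p) hs ⟩
      (g ^ p) ((g ^ n) h′)     ≡⟨ sym (^-+ p n h′) ⟩
      (g ^ (p + n)) h′         ≡⟨ cong (λ r → (g ^ r) h′) (+-comm p n) ⟩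
      (g ^ (n + p)) h′         ≡⟨ ^-+ n p h′ ⟩
      (g ^ n) ((g ^ p) h′)     ≡⟨ cong (g ^ n) hs′ ⟩
      (g ^ n) ((g ^ q) h″)     ≡⟨ sym (^-+ n q h″) ⟩
      (g ^ (n + q)) h″         ∎
    levels : (p + m) + k ≡ (n + q) + k″
    levels = begin
      (p + m) + k              ≡⟨ +-assoc p m k ⟩
      p + (m + k)              ≡⟨ cong (p +_) ks ⟩
      p + (n + k′)             ≡⟨ x∙yz≈y∙xz p n k′ ⟩
      n + (p + k′)             ≡⟨ cong (n +_) ks′ ⟩
      n + (q + k″)             ≡⟨ sym (+-assoc n q k″) ⟩
      (n + q) + k″             ∎

  raiseᵈ : Degree → Degree
  raiseᵈ (h , k) = h , suc k

  lowerᵈ : Degree → Degree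
  lowerᵈ (h , k) = g h , k

  raiseᵈ-cong : ∀ {d e} → d ≈ᵈ e → raiseᵈ d ≈ᵈ raiseᵈ e
  raiseᵈ-cong {h , k} {h′ , k′} (m , n , hs , ks) =
    m , n , hs , trans (+-suc m k) (trans (cong suc ks) (sym (+-suc n k′)))

  lowerᵈ-cong : ∀ {d e} → d ≈ᵈ e → lowerᵈ d ≈ᵈ lowerᵈ e
  lowerᵈ-cong {h , k} {h′ , k′} (m , n , hs , ks) =
    m , n , trans (^-comm m h) (trans (cong g hs) (sym (^-comm n h′))) , ks

  lowerᵈ-raiseᵈ : ∀ d → lowerᵈ (raiseᵈ d) ≈ᵈ d
  lowerᵈ-raiseᵈ (h , k) = 0 , 1 , refl , refl

  raiseᵈ-lowerᵈ : ∀ d → raiseᵈ (lowerᵈ d) ≈ᵈ d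
  raiseᵈ-lowerᵈ (h , k) = 0 , 1 , refl , refl

  lowerᵈ-irrefl : (∀ h → h < g h) → ∀ d → ¬ (lowerᵈ d ≈ᵈ d)
  lowerᵈ-irrefl inflationary (h , k) (m , n , hs , ks) with +-cancelʳ-≡ k m n ks
  ... | refl = <-irrefl (trans (sym hs) (^-comm m h)) (inflationary ((g ^ m) h))

  infixr 6 _⟶_
  infix  10 _⁺ _⁻

  data Skeleton : Set where
    ⟨_⟩ : Degree → Skeleton
    _⟶_ : Skeleton → Skeleton → Skeleton

  _⁺ : Skeleton → Skeleton
  ⟨ d ⟩ ⁺   = ⟨ raiseᵈ d ⟩
  (a ⟶ s) ⁺ = a ⟶ s ⁺

  _⁻ : Skeleton → Skeleton
  ⟨ d ⟩ ⁻   = ⟨ lowerᵈ d ⟩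
  (a ⟶ s) ⁻ = a ⟶ s ⁻

  infix 4 _≈_

  data _≈_ : Skeleton → Skeleton → Set where
    ⟨_⟩ : ∀ {d e} → d ≈ᵈ e → ⟨ d ⟩ ≈ ⟨ e ⟩
    _⟶_ : ∀ {a a′ s s′} → a ≈ a′ → s ≈ s′ → a ⟶ s ≈ a′ ⟶ s′

  ≈-refl : ∀ {s} → s ≈ s
  ≈-refl {⟨ d ⟩}   = ⟨ ≈ᵈ-refl ⟩
  ≈-refl {a ⟶ s} = ≈-refl ⟶ ≈-refl

  ≈-sym : ∀ {s s′} → s ≈ s′ → s′ ≈ s
  ≈-sym ⟨ d≈e ⟩   = ⟨ ≈ᵈ-sym d≈e ⟩
  ≈-sym (a≈ ⟶ s≈) = ≈-sym a≈ ⟶ ≈-sym s≈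

  ≈-trans : ∀ {s s′ s″} → s ≈ s′ → s′ ≈ s″ → s ≈ s″
  ≈-trans ⟨ d≈e ⟩   ⟨ e≈f ⟩     = ⟨ ≈ᵈ-trans d≈e e≈f ⟩
  ≈-trans (a≈ ⟶ s≈) (a≈′ ⟶ s≈′) = ≈-trans a≈ a≈′ ⟶ ≈-trans s≈ s≈′

  ⁺-cong : ∀ {s s′} → s ≈ s′ → s ⁺ ≈ s′ ⁺
  ⁺-cong ⟨ d≈e ⟩   = ⟨ raiseᵈ-cong d≈e ⟩
  ⁺-cong (a≈ ⟶ s≈) = a≈ ⟶ ⁺-cong s≈

  ⁻-cong : ∀ {s s′} → s ≈ s′ → s ⁻ ≈ s′ ⁻
  ⁻-cong ⟨ d≈e ⟩   = ⟨ lowerᵈ-cong d≈e ⟩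
  ⁻-cong (a≈ ⟶ s≈) = a≈ ⟶ ⁻-cong s≈

  ⁺⁻ : ∀ s → s ⁺ ⁻ ≈ s
  ⁺⁻ ⟨ d ⟩   = ⟨ lowerᵈ-raiseᵈ d ⟩
  ⁺⁻ (a ⟶ s) = ≈-refl ⟶ ⁺⁻ s

  ⁻⁺ : ∀ s → s ⁻ ⁺ ≈ s
  ⁻⁺ ⟨ d ⟩   = ⟨ raiseᵈ-lowerᵈ d ⟩
  ⁻⁺ (a ⟶ s) = ≈-refl ⟶ ⁻⁺ s

  ⁻-irrefl : (∀ h → h < g h) → ∀ s → ¬ (s ⁻ ≈ s)
  ⁻-irrefl inflationary ⟨ d ⟩   ⟨ d⁻≈d ⟩ = lowerᵈ-irrefl inflationary d d⁻≈d
  ⁻-irrefl inflationary (a ⟶ s) (_ ⟶ s⁻≈s) = ⁻-irrefl inflationary s s⁻≈s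

  Ctx : Set
  Ctx = ℕ → Skeleton

  infix 3 _⊩_∶_

  data _⊩_∶_ : Ctx → Tm → Skeleton → Set where
    ⊩-✶ : ∀ {Γ h} → Γ ⊩ ✶ h ∶ ⟨ h , 0 ⟩
    ⊩-` : ∀ {Γ i} → Γ ⊩ ` i ∶ Γ i
    ⊩-ƛ : ∀ {Γ W T a s} → Γ ⊩ W ∶ a → a ⁺ • Γ ⊩ T ∶ s → Γ ⊩ ƛ W T ∶ a ⟶ s
    ⊩-· : ∀ {Γ T V a s} → Γ ⊩ T ∶ a ⟶ s → Γ ⊩ V ∶ a ⁺ → Γ ⊩ T · V ∶ s
    ⊩-≈ : ∀ {Γ t s s′} → Γ ⊩ t ∶ s → s ≈ s′ → Γ ⊩ t ∶ s′

  ⊩-unique : ∀ {Γ Γ′ t s s′} → (∀ i → Γ i ≈ Γ′ i) → Γ ⊩ t ∶ s → Γ′ ⊩ t ∶ s′ → s ≈ s′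
  ⊩-unique Γ≈ (⊩-≈ t∶s s≈) t∶s′ = ≈-trans (≈-sym s≈) (⊩-unique Γ≈ t∶s t∶s′)
  ⊩-unique Γ≈ t∶s (⊩-≈ t∶s′ s′≈) = ≈-trans (⊩-unique Γ≈ t∶s t∶s′) s′≈
  ⊩-unique Γ≈ ⊩-✶ ⊩-✶ = ≈-refl
  ⊩-unique Γ≈ (⊩-` {i = i}) ⊩-` = Γ≈ i
  ⊩-unique {Γ} {Γ′} Γ≈ (⊩-ƛ {a = a} W∶a T∶s) (⊩-ƛ {a = a′} W∶a′ T∶s′) =
    a≈a′ ⟶ ⊩-unique Γ≈′ T∶s T∶s′
    where
    a≈a′ : a ≈ a′
    a≈a′ = ⊩-unique Γ≈ W∶a W∶a′
    Γ≈′ : ∀ i → (a ⁺ • Γ) i ≈ (a′ ⁺ • Γ′) i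
    Γ≈′ zero    = ⁺-cong a≈a′
    Γ≈′ (suc i) = Γ≈ i
  ⊩-unique Γ≈ (⊩-· T∶a⟶s _) (⊩-· T∶a′⟶s′ _) with ⊩-unique Γ≈ T∶a⟶s T∶a′⟶s′
  ... | _ ⟶ s≈s′ = s≈s′

  ⊩-functional : ∀ {Γ t s s′} → Γ ⊩ t ∶ s → Γ ⊩ t ∶ s′ → s ≈ s′
  ⊩-functional = ⊩-unique (λ _ → ≈-refl)

  ⊩-ƛ-inv : ∀ {Γ W T s} → Γ ⊩ ƛ W T ∶ s →
            ∃₂ λ a r → Γ ⊩ W ∶ a × a ⁺ • Γ ⊩ T ∶ r × a ⟶ r ≈ s
  ⊩-ƛ-inv (⊩-ƛ W∶a T∶r) = _ , _ , W∶a , T∶r , ≈-refl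
  ⊩-ƛ-inv (⊩-≈ ƛ∶s s≈) with ⊩-ƛ-inv ƛ∶s
  ... | a , r , W∶a , T∶r , ≈s = a , r , W∶a , T∶r , ≈-trans ≈s s≈

  ⊩-·-inv : ∀ {Γ T V s} → Γ ⊩ T · V ∶ s →
            ∃₂ λ a r → Γ ⊩ T ∶ a ⟶ r × Γ ⊩ V ∶ a ⁺ × r ≈ s
  ⊩-·-inv (⊩-· T∶a⟶r V∶a⁺) = _ , _ , T∶a⟶r , V∶a⁺ , ≈-refl
  ⊩-·-inv (⊩-≈ ·∶s s≈) with ⊩-·-inv ·∶s
  ... | a , r , T∶a⟶r , V∶a⁺ , ≈s = a , r , T∶a⟶r , V∶a⁺ , ≈-trans ≈s s≈

  ⊩-rename : ∀ {Γ Δ ρ t s} → (∀ i → Δ (ρ i) ≡ Γ i) → Γ ⊩ t ∶ s → Δ ⊩ rename ρ t ∶ s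
  ⊩-rename Δρ≡Γ ⊩-✶ = ⊩-✶
  ⊩-rename {Δ = Δ} {ρ} Δρ≡Γ (⊩-` {i = i}) = ≡.subst (Δ ⊩ ` ρ i ∶_) (Δρ≡Γ i) ⊩-`
  ⊩-rename {Γ} {Δ} {ρ} Δρ≡Γ (⊩-ƛ {a = a} W∶a T∶s) =
    ⊩-ƛ (⊩-rename Δρ≡Γ W∶a) (⊩-rename Δρ≡Γ′ T∶s)
    where
    Δρ≡Γ′ : ∀ i → (a ⁺ • Δ) (ext ρ i) ≡ (a ⁺ • Γ) i
    Δρ≡Γ′ zero    = refl
    Δρ≡Γ′ (suc i) = Δρ≡Γ i
  ⊩-rename Δρ≡Γ (⊩-· T∶ V∶) = ⊩-· (⊩-rename Δρ≡Γ T∶) (⊩-rename Δρ≡Γ V∶)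
  ⊩-rename Δρ≡Γ (⊩-≈ t∶s s≈) = ⊩-≈ (⊩-rename Δρ≡Γ t∶s) s≈

  ⊩-subst : ∀ {Γ Δ σ t s} → (∀ i → Δ ⊩ σ i ∶ Γ i) → Γ ⊩ t ∶ s → Δ ⊩ subst σ t ∶ s
  ⊩-subst σ∶Γ ⊩-✶ = ⊩-✶
  ⊩-subst σ∶Γ (⊩-` {i = i}) = σ∶Γ i
  ⊩-subst {Γ} {Δ} {σ} σ∶Γ (⊩-ƛ {a = a} W∶a T∶s) =
    ⊩-ƛ (⊩-subst σ∶Γ W∶a) (⊩-subst σ∶Γ′ T∶s)
    where
    σ∶Γ′ : ∀ i → a ⁺ • Δ ⊩ exts σ i ∶ (a ⁺ • Γ) i
    σ∶Γ′ zero    = ⊩-`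
    σ∶Γ′ (suc i) = ⊩-rename (λ _ → refl) (σ∶Γ i)
  ⊩-subst σ∶Γ (⊩-· T∶ V∶) = ⊩-· (⊩-subst σ∶Γ T∶) (⊩-subst σ∶Γ V∶)
  ⊩-subst σ∶Γ (⊩-≈ t∶s s≈) = ⊩-≈ (⊩-subst σ∶Γ t∶s) s≈

  ⊩-[] : ∀ {Γ T V a s} → a • Γ ⊩ T ∶ s → Γ ⊩ V ∶ a → Γ ⊩ T [ V ] ∶ s
  ⊩-[] {Γ} {V = V} {a} T∶s V∶a = ⊩-subst V•∶ T∶s
    where
    V•∶ : ∀ i → Γ ⊩ (V • `_) i ∶ (a • Γ) i
    V•∶ zero    = V∶a
    V•∶ (suc i) = ⊩-`

  ⊩-⇛ : ∀ {Γ t t′ s} → t ⇛ t′ → Γ ⊩ t ∶ s → Γ ⊩ t′ ∶ s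
  ⊩-⇛ ⇛-✶ t∶s = t∶s
  ⊩-⇛ ⇛-` t∶s = t∶s
  ⊩-⇛ (⇛-ƛ W⇛ T⇛) ƛ∶s with ⊩-ƛ-inv ƛ∶s
  ... | a , r , W∶a , T∶r , ≈s = ⊩-≈ (⊩-ƛ (⊩-⇛ W⇛ W∶a) (⊩-⇛ T⇛ T∶r)) ≈s
  ⊩-⇛ (⇛-· T⇛ V⇛) ·∶s with ⊩-·-inv ·∶s
  ... | a , r , T∶a⟶r , V∶a⁺ , ≈s = ⊩-≈ (⊩-· (⊩-⇛ T⇛ T∶a⟶r) (⊩-⇛ V⇛ V∶a⁺)) ≈s
  ⊩-⇛ (⇛-β T⇛ V⇛) ·∶s with ⊩-·-inv ·∶s
  ... | a , r , ƛ∶a⟶r , V∶a⁺ , r≈s with ⊩-ƛ-inv ƛ∶a⟶r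
  ...   | a′ , r′ , _ , T∶r′ , a′≈a ⟶ r′≈r =
    ⊩-≈ (⊩-[] (⊩-⇛ T⇛ T∶r′) (⊩-≈ (⊩-⇛ V⇛ V∶a⁺) (⁺-cong (≈-sym a′≈a)))) (≈-trans r′≈r r≈s)

  ⊩-⇛* : ∀ {Γ t t′ s} → Star _⇛_ t t′ → Γ ⊩ t ∶ s → Γ ⊩ t′ ∶ s
  ⊩-⇛* ε        t∶s = t∶s
  ⊩-⇛* (p ◅ ps) t∶s = ⊩-⇛* ps (⊩-⇛ p t∶s)

  ⊩-convertible : ∀ {Γ t u s s′} → EqClosure _⇛_ t u → Γ ⊩ t ∶ s → Γ ⊩ u ∶ s′ → s ≈ s′
  ⊩-convertible t≡u t∶s u∶s′ with church-rosser t≡u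
  ... | c , t⇛*c , u⇛*c = ⊩-functional (⊩-⇛* t⇛*c t∶s) (⊩-⇛* u⇛*c u∶s′)

  infix 3 _⊩_∶∶_

  record _⊩_∶∶_ (Γ : Ctx) (t u : Tm) : Set where
    constructor stratified
    field
      skeleton : Skeleton
      term     : Γ ⊩ t ∶ skeleton
      type     : Γ ⊩ u ∶ skeleton ⁻

  ∶∶-weaken : ∀ {Γ ρ t u} → Γ ∘ ρ ⊩ t ∶∶ u → Γ ⊩ rename ρ t ∶∶ rename ρ u
  ∶∶-weaken (stratified s t∶s u∶s⁻) =
    stratified s (⊩-rename (λ _ → refl) t∶s) (⊩-rename (λ _ → refl) u∶s⁻)

  ∶∶-· : ∀ {Γ t u v w} → Γ ⊩ v ∶∶ w → Γ ⊩ t ∶∶ ƛ w u → Γ ⊩ t · v ∶∶ ƛ w u · v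
  ∶∶-· _ (stratified ⟨ _ ⟩ _ ƛ∶d⁻) with ⊩-ƛ-inv ƛ∶d⁻
  ... | _ , _ , _ , _ , ()
  ∶∶-· {Γ} {v = v} (stratified a v∶a w∶a⁻) (stratified (b ⟶ r) t∶b⟶r ƛ∶b⟶r⁻)
    with ⊩-ƛ-inv ƛ∶b⟶r⁻
  ... | a′ , _ , w∶a′ , _ , a′≈b ⟶ _ = stratified r (⊩-· t∶b⟶r v∶b⁺) (⊩-· ƛ∶b⟶r⁻ v∶b⁺)
    where
    a≈b⁺ : a ≈ b ⁺
    a≈b⁺ = ≈-trans (≈-sym (⁻⁺ a)) (⁺-cong (≈-trans (⊩-functional w∶a⁻ w∶a′) a′≈b))
    v∶b⁺ : Γ ⊩ v ∶ b ⁺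
    v∶b⁺ = ⊩-≈ v∶a a≈b⁺

  ∶∶-convertible : ∀ {Γ t u u′ s} → Γ ⊩ u′ ∶ s → Γ ⊩ t ∶∶ u → EqClosure _⇛_ u u′ →
                   Γ ⊩ t ∶∶ u′
  ∶∶-convertible u′∶s (stratified r t∶r u∶r⁻) u≡u′ =
    stratified r t∶r (⊩-≈ u′∶s (≈-sym (⊩-convertible u≡u′ u∶r⁻ u′∶s)))

  ∶∶-irreflexive : (∀ h → h < g h) → ∀ {Γ t u} → Γ ⊩ t ∶∶ u → ¬ EqClosure _⇛_ u t
  ∶∶-irreflexive inflationary (stratified s t∶s u∶s⁻) u≡t =
    ⁻-irrefl inflationary s (⊩-convertible u≡t u∶s⁻ t∶s)

-- Environments

data Item : Set where
  decl : Term → Item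
  def  : Term → Item

bind : Item → Env → Env
bind (decl W) = lamE W
bind (def V)  = abbrE V

-- Innermost binder first, so that the variable with index i is bound by the i-th item.

items : Env → List Item
items (⋆ _)       = []
items (lamE W C)  = items C ++ (decl W ∷ [])
items (abbrE V C) = items C ++ (def V ∷ [])
items (applE _ C) = items C
items (castE _ C) = items C

items-graft : ∀ C D → items (graft C D) ≡ items D ++ items C
items-graft (⋆ _)       D = sym (++-identityʳ (items D))
items-graft (lamE W C)  D =
  trans (cong (_++ (decl W ∷ [])) (items-graft C D)) (++-assoc (items D) (items C) _)
items-graft (abbrE V C) D =
  trans (cong (_++ (def V ∷ [])) (items-graft C D)) (++-assoc (items D) (items C) _)
items-graft (applE _ C) D = items-graft C D
items-graft (castE _ C) D = items-graft C D

items-∙λ : ∀ E W → items (E ∙λ W) ≡ decl W ∷ items E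
items-∙λ E W = items-graft E (lamE W (⋆ (tsort E)))

items-∙δ : ∀ E V → items (E ∙δ V) ≡ def V ∷ items E
items-∙δ E V = items-graft E (abbrE V (⋆ (tsort E)))

length-items : ∀ C → length (items C) ≡ binders C
length-items (⋆ _)       = refl
length-items (lamE W C)  =
  trans (length-++ (items C)) (trans (+-comm _ 1) (cong suc (length-items C)))
length-items (abbrE V C) =
  trans (length-++ (items C)) (trans (+-comm _ 1) (cong suc (length-items C)))
length-items (applE _ C) = length-items C
length-items (castE _ C) = length-items C

items-bind : ∀ x C → items (bind x C) ≡ items C ++ (x ∷ [])
items-bind (decl W) C = refl
items-bind (def V)  C = refl

items-split : ∀ C₁ x C₂ → items (graft C₁ (bind x C₂)) ≡ items C₂ ++ x ∷ items C₁
items-split C₁ x C₂ = begin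
  items (graft C₁ (bind x C₂))        ≡⟨ items-graft C₁ (bind x C₂) ⟩
  items (bind x C₂) ++ items C₁       ≡⟨ cong (_++ items C₁) (items-bind x C₂) ⟩
  (items C₂ ++ (x ∷ [])) ++ items C₁  ≡⟨ ++-assoc (items C₂) (x ∷ []) (items C₁) ⟩
  items C₂ ++ x ∷ items C₁            ∎
  where open ≡-Reasoning

at-binder : ∀ C₁ x C₂ (P : List Item → ℕ → Set) →
            P (items C₂ ++ x ∷ items C₁) (length (items C₂)) →
            P (items (graft C₁ (bind x C₂))) (binders C₂)
at-binder C₁ x C₂ P =
  ≡.subst₂ P (sym (items-split C₁ x C₂)) (length-items C₂)

decls : List Item → ℕ
decls []           = 0
decls (decl _ ∷ L) = suc (decls L)
decls (def _ ∷ L)  = decls L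

-- Under L, a term lives in the context of the declarations of L only: every defined variable
-- is replaced by the expansion of its definition.

expand : List Item → Subst
expand []           = `_
expand (decl W ∷ L) = exts (expand L)
expand (def V ∷ L)  = subst (expand L) ⟦ V ⟧ • expand L

⟦_⟧⟨_⟩ : Term → List Item → Tm
⟦ T ⟧⟨ L ⟩ = subst (expand L) ⟦ T ⟧

expand-++ : ∀ P L j → expand (P ++ L) (length P + j) ≡ rename (decls P +_) (expand L j)
expand-++ []           L j = sym (rename-id (expand L j))
expand-++ (decl _ ∷ P) L j =
  trans (cong (rename suc) (expand-++ P L j)) (rename-rename suc (decls P +_) (expand L j))
expand-++ (def _ ∷ P)  L j = expand-++ P L j

⟦var⟧⟨++⟩ : ∀ P L → ⟦ var (length P) ⟧⟨ P ++ L ⟩ ≡ rename (decls P +_) (expand L 0)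
⟦var⟧⟨++⟩ P L = trans (cong (expand (P ++ L)) (sym (+-identityʳ (length P)))) (expand-++ P L 0)

⟦lift⟧⟨++⟩ : ∀ P L T → ⟦ lift (suc (length P)) 0 T ⟧⟨ P ++ L ⟩ ≡
                       rename (decls P +_) (subst (expand L ∘ suc) ⟦ T ⟧)
⟦lift⟧⟨++⟩ P L T = begin
  ⟦ lift (suc (length P)) 0 T ⟧⟨ P ++ L ⟩
    ≡⟨ subst-⟦lift⟧ (expand (P ++ L)) (suc (length P)) T ⟩
  subst (expand (P ++ L) ∘ (suc (length P) +_)) ⟦ T ⟧
    ≡⟨ subst-cong shift ⟦ T ⟧ ⟩
  subst (rename (decls P +_) ∘ expand L ∘ suc) ⟦ T ⟧
    ≡⟨ sym (rename-subst (decls P +_) (expand L ∘ suc) ⟦ T ⟧) ⟩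
  rename (decls P +_) (subst (expand L ∘ suc) ⟦ T ⟧) ∎
  where
  open ≡-Reasoning
  shift : expand (P ++ L) ∘ (suc (length P) +_) ≗ rename (decls P +_) ∘ expand L ∘ suc
  shift i = trans (cong (expand (P ++ L)) (sym (+-suc (length P) i))) (expand-++ P L (suc i))

⟦var⟧≡⟦lift⟧⟨++⟩ : ∀ P V M → ⟦ var (length P) ⟧⟨ P ++ def V ∷ M ⟩ ≡
                             ⟦ lift (suc (length P)) 0 V ⟧⟨ P ++ def V ∷ M ⟩
⟦var⟧≡⟦lift⟧⟨++⟩ P V M = trans (⟦var⟧⟨++⟩ P (def V ∷ M)) (sym (⟦lift⟧⟨++⟩ P (def V ∷ M) V))

⟦⟧⟨⟩-δ : ∀ P V M {A A′ B} →
         A ⇒₀ A′ → StrictSub (length P) (lift (suc (length P)) 0 V) A′ B →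
         ⟦ A ⟧⟨ P ++ def V ∷ M ⟩ ⇛ ⟦ B ⟧⟨ P ++ def V ∷ M ⟩
⟦⟧⟨⟩-δ P V M A⇒A′ A′↦B =
  ≡.subst (_ ⇛_) (sym (subst-⟦Sub⟧ A′↦B (expand (P ++ def V ∷ M)) (⟦var⟧≡⟦lift⟧⟨++⟩ P V M)))
    (⇛-subst (λ _ → ⇛-refl) (⟦⟧-⇛ A⇒A′))

⟦⟧⟨⟩-⇒ : ∀ {E A B} → E ⊢ A ⇒ B → ⟦ A ⟧⟨ items E ⟩ ⇛ ⟦ B ⟧⟨ items E ⟩
⟦⟧⟨⟩-⇒ (e-free A⇒B) = ⇛-subst (λ _ → ⇛-refl) (⟦⟧-⇛ A⇒B)
⟦⟧⟨⟩-⇒ {A = A} {B} (e-δ {C₁} {C₂} {V} {T′ = A′} refl A⇒A′ A′↦B) =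
  at-binder C₁ (def V) C₂ (λ L n → StrictSub n (lift (suc n) 0 V) A′ B → ⟦ A ⟧⟨ L ⟩ ⇛ ⟦ B ⟧⟨ L ⟩)
    (⟦⟧⟨⟩-δ (items C₂) V (items C₁) A⇒A′) A′↦B

⟦⟧⟨⟩-⇔ : ∀ {E A B} → E ⊢ A ⇔ B → EqClosure _⇛_ ⟦ A ⟧⟨ items E ⟩ ⟦ B ⟧⟨ items E ⟩
⟦⟧⟨⟩-⇔ = EqClosure.gmap _ ⟦⟧⟨⟩-⇒

module Stratification (g : ℕ → ℕ) where

  open Skeletons g

  Fits : List Item → Ctx → Set
  Fits []           Γ = ⊤
  Fits (decl W ∷ L) Γ = Fits L (Γ ∘ suc) × (∀ {a} → Γ ∘ suc ⊩ ⟦ W ⟧⟨ L ⟩ ∶ a → Γ 0 ≈ a ⁺)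
  Fits (def _ ∷ L)  Γ = Fits L Γ

  Fits-++ : ∀ P {L Γ} → Fits (P ++ L) Γ → Fits L (Γ ∘ (decls P +_))
  Fits-++ []           fits       = fits
  Fits-++ (decl _ ∷ P) (fits , _) = Fits-++ P fits
  Fits-++ (def _ ∷ P)  fits       = Fits-++ P fits

  -- Whether a declared type has a skeleton need not be decidable (≈ᵈ quantifies over iterates
  -- of g), so a fitting context exists only classically; as the theorem is a negation, the
  -- double negation suffices.

  fits-exists : ∀ L → ¬ ¬ ∃ (Fits L)
  fits-exists []           = λ ¬fits → ¬fits ((λ _ → ⟨ 0 , 0 ⟩) , tt)
  fits-exists (def _ ∷ L)  = fits-exists L
  fits-exists (decl W ∷ L) = do
      (Γ , fits) ← fits-exists L
      typable? ← ¬¬-excluded-middle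
      pure (extend Γ fits typable?)
    where
    open RawMonad ¬¬-Monad
    extend : ∀ Γ → Fits L Γ → Dec (∃ (Γ ⊩ ⟦ W ⟧⟨ L ⟩ ∶_)) → ∃ (Fits (decl W ∷ L))
    extend Γ fits (yes (a , W∶a)) = a ⁺ • Γ , fits , λ W∶b → ⁺-cong (⊩-functional W∶a W∶b)
    extend Γ fits (no untypable)  = ⟨ 0 , 0 ⟩ • Γ , fits , λ W∶b → ⊥-elim (untypable (_ , W∶b))

  record Stratifies (L : List Item) (T U : Term) : Set where
    field
      at : ∀ {Γ} → Fits L Γ → Γ ⊩ ⟦ T ⟧⟨ L ⟩ ∶∶ ⟦ U ⟧⟨ L ⟩

  open Stratifies

  stratify-sort : ∀ {L h} → Stratifies L (sort h) (sort (g h))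
  stratify-sort {h = h} .at _ = stratified ⟨ h , 0 ⟩ ⊩-✶ ⊩-✶

  stratify-def : ∀ P {V W M} → Stratifies M V W →
                 Stratifies (P ++ def V ∷ M) (var (length P)) (lift (suc (length P)) 0 W)
  stratify-def P {V} {W} {M} V∶∶W .at fits =
    ≡.subst₂ (_ ⊩_∶∶_) (sym (⟦var⟧⟨++⟩ P (def V ∷ M))) (sym (⟦lift⟧⟨++⟩ P (def V ∷ M) W))
      (∶∶-weaken (V∶∶W .at (Fits-++ P fits)))

  stratify-decl : ∀ P {W V M} → Stratifies M W V →
                  Stratifies (P ++ decl W ∷ M) (var (length P)) (lift (suc (length P)) 0 W)
  stratify-decl P {W} {V} {M} W∶∶V .at {Γ} fits =
    ≡.subst₂ (_ ⊩_∶∶_) (sym (⟦var⟧⟨++⟩ P (decl W ∷ M))) (sym W-weakened)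
      (stratified x ⊩-` (⊩-≈ (⊩-rename (λ _ → refl) W∶a) a≈x⁻))
    where
    x : Skeleton
    x = Γ (decls P + 0)
    open _⊩_∶∶_ (W∶∶V .at (proj₁ (Fits-++ P fits))) renaming (skeleton to a; term to W∶a)
    a≈x⁻ : a ≈ x ⁻
    a≈x⁻ = ≈-trans (≈-sym (⁺⁻ a)) (⁻-cong (≈-sym (proj₂ (Fits-++ P fits) W∶a)))
    W-weakened : ⟦ lift (suc (length P)) 0 W ⟧⟨ P ++ decl W ∷ M ⟩ ≡
                 rename (λ i → decls P + suc i) ⟦ W ⟧⟨ M ⟩
    W-weakened = begin
      ⟦ lift (suc (length P)) 0 W ⟧⟨ P ++ decl W ∷ M ⟩
        ≡⟨ ⟦lift⟧⟨++⟩ P (decl W ∷ M) W ⟩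
      rename (decls P +_) (subst (rename suc ∘ expand M) ⟦ W ⟧)
        ≡⟨ cong (rename (decls P +_)) (sym (rename-subst suc (expand M) ⟦ W ⟧)) ⟩
      rename (decls P +_) (rename suc ⟦ W ⟧⟨ M ⟩)
        ≡⟨ rename-rename (decls P +_) suc ⟦ W ⟧⟨ M ⟩ ⟩
      rename (λ i → decls P + suc i) ⟦ W ⟧⟨ M ⟩ ∎
      where open ≡-Reasoning

  stratify-abbr : ∀ {L V T U} → Stratifies (def V ∷ L) T U → Stratifies L (abbr V T) (abbr V U)
  stratify-abbr {L} {V} {T} {U} T∶∶U .at fits =
    ≡.subst₂ (_ ⊩_∶∶_) (sym (subst-[] (expand L) ⟦ T ⟧ ⟦ V ⟧))
                       (sym (subst-[] (expand L) ⟦ U ⟧ ⟦ V ⟧))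
      (T∶∶U .at fits)

  stratify-abst : ∀ {L W V T U} → Stratifies L W V → Stratifies (decl W ∷ L) T U →
                  Stratifies L (lam W T) (lam W U)
  stratify-abst W∶∶V T∶∶U .at fits with W∶∶V .at fits
  ... | stratified a W∶a _ with T∶∶U .at (fits , λ W∶b → ⁺-cong (⊩-functional W∶a W∶b))
  ...   | stratified s T∶s U∶s⁻ = stratified (a ⟶ s) (⊩-ƛ W∶a T∶s) (⊩-ƛ W∶a U∶s⁻)

  stratify-appl : ∀ {L V W T U} → Stratifies L V W → Stratifies L T (lam W U) →
                  Stratifies L (appl V T) (appl V (lam W U))
  stratify-appl V∶∶W T∶∶λWU .at fits = ∶∶-· (V∶∶W .at fits) (T∶∶λWU .at fits)

  stratify-cast : ∀ {L T W V} → Stratifies L T W → Stratifies L (cast W T) (cast V W)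
  stratify-cast T∶∶W .at = T∶∶W .at

  stratify-conv : ∀ {L T U₁ U₂ W} → Stratifies L U₂ W → Stratifies L T U₁ →
                  EqClosure _⇛_ ⟦ U₁ ⟧⟨ L ⟩ ⟦ U₂ ⟧⟨ L ⟩ → Stratifies L T U₂
  stratify-conv U₂∶∶W T∶∶U₁ U₁≡U₂ .at fits =
    ∶∶-convertible (_⊩_∶∶_.term (U₂∶∶W .at fits)) (T∶∶U₁ .at fits) U₁≡U₂

  stratify : ∀ {E T U} → E ⊢[ g ] T ∶ U → Stratifies (items E) T U
  stratify t-sort = stratify-sort
  stratify (t-def {C₁ = C₁} {C₂} {V} {W} refl V∶W) =
    at-binder C₁ (def V) C₂ (λ L n → Stratifies L (var n) (lift (suc n) 0 W))
      (stratify-def (items C₂) (stratify V∶W))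
  stratify (t-decl {C₁ = C₁} {C₂} {V} {W} refl W∶V) =
    at-binder C₁ (decl W) C₂ (λ L n → Stratifies L (var n) (lift (suc n) 0 W))
      (stratify-decl (items C₂) (stratify W∶V))
  stratify (t-abbr {E} {V = V} {T = T} {U} _ T∶U) =
    stratify-abbr (≡.subst (λ L → Stratifies L T U) (items-∙δ E V) (stratify T∶U))
  stratify (t-abst {E} {W = W} {T} {U} W∶V T∶U) =
    stratify-abst (stratify W∶V)
      (≡.subst (λ L → Stratifies L T U) (items-∙λ E W) (stratify T∶U))
  stratify (t-appl V∶W T∶λWU) = stratify-appl (stratify V∶W) (stratify T∶λWU)
  stratify (t-cast T∶W _) = stratify-cast (stratify T∶W)
  stratify (t-conv U₂∶W T∶U₁ U₁⇔U₂) =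
    stratify-conv (stratify U₂∶W) (stratify T∶U₁) (⟦⟧⟨⟩-⇔ U₁⇔U₂)

mainTheorem13 : (g : ℕ → ℕ) → (∀ h → h < g h) →
                ∀ (C : Env) (T U : Term) →
                C ⊢[ g ] T ∶ U → ¬ (C ⊢ U ⇔ T)
mainTheorem13 g inflationary C T U T∶U U⇔T =
  fits-exists (items C) λ (Γ , fits) →
    ∶∶-irreflexive inflationary (stratify T∶U .at fits) (⟦⟧⟨⟩-⇔ U⇔T)
  where
  open Skeletons g
  open Stratification g
  open Stratifies
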